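{- Let $N$ be a positive integer, let $X\subseteq[2^N]$, and let $I_1,I_2$ be two intervals in $X$ with $|I_1|\leq |I_2|$. If $I_1$ and $I_2$ are both closed in $X$, then either $I_1\cap I_2=\emptyset$ or $I_1\subseteq I_2$.
   Context: Let $T_{[2^N]}$ be the complete binary tree of height $N$ with $2^{N+1}-1$ vertices whose leaves are identified, from left to right, with $1,2,\dots,2^N$. Levels are numbered $1,\dots,N+1$, the root being at level $1$ and the leaves at level $N+1$; $\pi(u)$ denotes the level of vertex $u$. A vertex $u$ is an ancestor of $v$ if $\pi(u)<\pi(v)$ and $u$ lies on the path from the root to $v$. For distinct leaves $x,y$, $a(x,y)$ is the ancestor of both $x$ and $y$ of highest level (greatest common ancestor); for $x=y$ put $a(x,x)=x$. Write $X=\{x_1<\dots<x_t\}$. For a vertex $u$, $X(u)$ denotes the set of $x\in X$ such that $u$ is an ancestor of $x$ or $u=x$. An interval in $X$ is a set of consecutive elements $I=\{x_p,x_{p+1},\dots,x_q\}$ with $1\le p\le q\le t$; it is closed in $X$ if $I=X(a(x_p,x_q))$ (equivalently, $a(x_p,x_q)$ is not an ancestor of any element of $X\setminus I$). -}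

module Defs where

open import Data.Nat using (ℕ; _≤_; _<_; _^_; _∸_; suc; _/_)
open import Data.Nat.Properties using (m^n≢0)
open import Data.Fin using (Fin; toℕ)
open import Data.Fin.Properties using (_≤?_)
open import Data.Fin.Subset using (Subset; _∈_; inside; outside)
open import Data.Fin.Subset.Properties using (_∈?_)
open import Data.Vec using (tabulate)
open import Data.Bool using (_∧_; if_then_else_)
open import Data.Product using (_×_; Σ)
open import Relation.Binary.PropositionalEquality using (_≡_)
open import Relation.Nullary.Decidable using (⌊_⌋)
open import Function.Bundles using (_⇔_)

-- Leaves of T_[2^N]: leaf number k ∈ {1,…,2^N} is represented by
-- the element i : Fin (2 ^ N) with toℕ i + 1 = k (order preserved).
Leaf : ℕ → Set
Leaf N = Fin (2 ^ N)

-- A vertex of the complete binary tree of height N: it sits at depth d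
-- (level π(u) = d + 1, 0 ≤ d ≤ N) and is the (index)-th vertex from the
-- left at that depth (0 ≤ index < 2^d).  Depth N vertices are the leaves.
record Vertex (N : ℕ) : Set where
  constructor vtx
  field
    depth    : ℕ
    depth≤N  : depth ≤ N
    index    : ℕ
    index<   : index < 2 ^ depth
open Vertex public

level : ∀ {N} → Vertex N → ℕ
level u = suc (depth u)

-- "u is an ancestor of leaf x, or u = x": the leaves below the vertex at
-- depth d with index j are exactly those with (0-based) position p
-- satisfying p / 2^(N-d) = j.
AncOrSelf : ∀ {N} → Vertex N → Leaf N → Set
AncOrSelf {N} u x =
  (toℕ x / (2 ^ (N ∸ depth u))) {{m^n≢0 2 (N ∸ depth u)}} ≡ index u

-- u = a(x,y): common ancestor (or self) of x and y of highest level.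
-- (For x = y this forces u = x, matching the convention a(x,x) = x.)
IsGCA : ∀ {N} → Vertex N → Leaf N → Leaf N → Set
IsGCA {N} u x y =
  AncOrSelf u x × AncOrSelf u y ×
  (∀ (v : Vertex N) → AncOrSelf v x → AncOrSelf v y → level v ≤ level u)

-- The interval of X with first element lo and last element hi:
-- all elements x of X with lo ≤ x ≤ hi (the consecutive elements
-- x_p, …, x_q of X when lo = x_p, hi = x_q).
interval : ∀ {N} → Subset (2 ^ N) → Leaf N → Leaf N → Subset (2 ^ N)
interval X lo hi =
  tabulate (λ x → if ⌊ x ∈? X ⌋ ∧ ⌊ lo ≤? x ⌋ ∧ ⌊ x ≤? hi ⌋
                    then inside else outside)

IsIntervalEnds : ∀ {N} → Subset (2 ^ N) → Leaf N → Leaf N → Set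
IsIntervalEnds X lo hi = lo ∈ X × hi ∈ X × Data.Fin._≤_ lo hi

ClosedIn : ∀ {N} → Subset (2 ^ N) → Leaf N → Leaf N → Set
ClosedIn {N} X lo hi =
  Σ (Vertex N) λ u → IsGCA u lo hi ×
    (∀ (x : Leaf N) → (x ∈ interval {N} X lo hi) ⇔ (x ∈ X × AncOrSelf u x))

{-# OPTIONS --safe #-}
module Submission where

open import Defs
open import Data.Nat using (ℕ; _≤_; _^_)
open import Data.Fin.Subset using (Subset; _∩_; _⊆_; Empty; ∣_∣)
open import Data.Sum using (_⊎_)

open import Data.Nat using (_/_; _∸_; _+_; _*_; _≤?_; NonZero)
open import Data.Nat.Properties
  using (m^n≢0; m*n≢0; ^-distribˡ-+-*; m∸n+n≡m; +-∸-assoc; <⇒≱; ≰⇒≥)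
open import Data.Nat.DivMod using (/-congʳ; m/n/o≡m/[n*o])
open import Data.Fin using (toℕ)
open import Data.Fin.Subset using (_∈_)
open import Data.Fin.Subset.Properties using (_∈?_; p⊂q⇒∣p∣<∣q∣; nonempty?; x∈p∩q⁻)
open import Data.Empty using (⊥-elim)
open import Data.Product using (_×_; _,_; proj₁; proj₂)
open import Data.Sum using (inj₁; inj₂)
open import Relation.Nullary using (yes; no)
open import Relation.Binary.PropositionalEquality using (_≡_; sym; trans; cong; module ≡-Reasoning)
open import Function.Bundles using (_⇔_; Equivalence)

-- Leaf sets of two vertices of a tree are either
-- disjoint or nested, so two closed intervals sharing an element are nested;
-- if the larger one were inside the smaller, they would coincide.

infixl 7 _/2^_

_/2^_ : ℕ → ℕ → ℕ
y /2^ k = (y / 2 ^ k) {{m^n≢0 2 k}}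

/2^-+ : ∀ y a b → y /2^ (a + b) ≡ y /2^ a /2^ b
/2^-+ y a b = begin
  y /2^ (a + b)                  ≡⟨ /-congʳ {{nz₁}} {{nz₂}} (^-distribˡ-+-* 2 a b) ⟩
  (y / (2 ^ a * 2 ^ b)) {{nz₂}}  ≡⟨ m/n/o≡m/[n*o] y (2 ^ a) (2 ^ b) {{nzᵃ}} {{nzᵇ}} {{nz₂}} ⟨
  y /2^ a /2^ b                  ∎
  where
  open ≡-Reasoning
  nzᵃ : NonZero (2 ^ a)
  nzᵃ = m^n≢0 2 a
  nzᵇ : NonZero (2 ^ b)
  nzᵇ = m^n≢0 2 b
  nz₁ : NonZero (2 ^ (a + b))
  nz₁ = m^n≢0 2 (a + b)
  nz₂ : NonZero (2 ^ a * 2 ^ b)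
  nz₂ = m*n≢0 (2 ^ a) (2 ^ b) {{nzᵃ}} {{nzᵇ}}

N∸d≡[N∸e]+[e∸d] : ∀ {N d e} → d ≤ e → e ≤ N → N ∸ d ≡ (N ∸ e) + (e ∸ d)
N∸d≡[N∸e]+[e∸d] {N} {d} {e} d≤e e≤N = begin
  N ∸ d                 ≡⟨ cong (_∸ d) (m∸n+n≡m e≤N) ⟨
  (N ∸ e) + e ∸ d       ≡⟨ +-∸-assoc (N ∸ e) d≤e ⟩
  (N ∸ e) + (e ∸ d)     ∎
  where open ≡-Reasoning

AncOrSelf-nested : ∀ {N} (u v : Vertex N) → depth u ≤ depth v → ∀ {x y} →
  AncOrSelf u x → AncOrSelf v x → AncOrSelf v y → AncOrSelf u y
AncOrSelf-nested {N} u v du≤dv {x} {y} ux vx vy = begin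
  toℕ y /2^ (N ∸ depth u)                            ≡⟨ split (toℕ y) ⟩
  toℕ y /2^ (N ∸ depth v) /2^ (depth v ∸ depth u)    ≡⟨ cong (_/2^ (depth v ∸ depth u)) (trans vy (sym vx)) ⟩
  toℕ x /2^ (N ∸ depth v) /2^ (depth v ∸ depth u)    ≡⟨ split (toℕ x) ⟨
  toℕ x /2^ (N ∸ depth u)                            ≡⟨ ux ⟩
  index u                                            ∎
  where
  open ≡-Reasoning
  split : ∀ z → z /2^ (N ∸ depth u) ≡ z /2^ (N ∸ depth v) /2^ (depth v ∸ depth u)
  split z = trans (cong (z /2^_) (N∸d≡[N∸e]+[e∸d] du≤dv (depth≤N v)))
                  (/2^-+ z (N ∸ depth v) (depth v ∸ depth u))

p⊆q⇒∣q∣≤∣p∣⇒q⊆p : ∀ {n} {p q : Subset n} → p ⊆ q → ∣ q ∣ ≤ ∣ p ∣ → q ⊆ p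
p⊆q⇒∣q∣≤∣p∣⇒q⊆p {p = p} p⊆q ∣q∣≤∣p∣ {x} x∈q with x ∈? p
... | yes x∈p = x∈p
... | no x∉p  = ⊥-elim (<⇒≱ (p⊂q⇒∣p∣<∣q∣ (p⊆q , x , x∈q , x∉p)) ∣q∣≤∣p∣)

IsTraceBelow : ∀ {N} → Subset (2 ^ N) → Vertex N → Subset (2 ^ N) → Set
IsTraceBelow {N} X u I = ∀ (y : Leaf N) → (y ∈ I) ⇔ (y ∈ X × AncOrSelf u y)

IsTraceBelow-⊆ : ∀ {N} {X I J : Subset (2 ^ N)} (u v : Vertex N) → depth u ≤ depth v →
  IsTraceBelow X u I → IsTraceBelow X v J → ∀ {x} → x ∈ I → x ∈ J → J ⊆ I
IsTraceBelow-⊆ u v du≤dv I≡ J≡ {x} x∈I x∈J {y} y∈J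
  with Equivalence.to (I≡ x) x∈I | Equivalence.to (J≡ x) x∈J | Equivalence.to (J≡ y) y∈J
... | _ , ux | _ , vx | y∈X , vy =
  Equivalence.from (I≡ y) (y∈X , AncOrSelf-nested u v du≤dv ux vx vy)

ClosedIn-comparable : ∀ {N} (X : Subset (2 ^ N)) {p₁ q₁ p₂ q₂ x : Leaf N} →
  ClosedIn {N} X p₁ q₁ → ClosedIn {N} X p₂ q₂ →
  x ∈ interval {N} X p₁ q₁ → x ∈ interval {N} X p₂ q₂ →
  interval {N} X p₁ q₁ ⊆ interval {N} X p₂ q₂ ⊎
  interval {N} X p₂ q₂ ⊆ interval {N} X p₁ q₁
ClosedIn-comparable X (u₁ , _ , I₁≡) (u₂ , _ , I₂≡) x∈I₁ x∈I₂ with depth u₁ ≤? depth u₂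
... | yes d₁≤d₂ = inj₂ (IsTraceBelow-⊆ u₁ u₂ d₁≤d₂ I₁≡ I₂≡ x∈I₁ x∈I₂)
... | no  d₁≰d₂ = inj₁ (IsTraceBelow-⊆ u₂ u₁ (≰⇒≥ d₁≰d₂) I₂≡ I₁≡ x∈I₂ x∈I₁)

proposition2p3 : (N : ℕ) → 1 ≤ N → (X : Subset (2 ^ N)) →
    (p₁ q₁ p₂ q₂ : Leaf N) →
    IsIntervalEnds {N} X p₁ q₁ → IsIntervalEnds {N} X p₂ q₂ →
    ∣ interval {N} X p₁ q₁ ∣ ≤ ∣ interval {N} X p₂ q₂ ∣ →
    ClosedIn {N} X p₁ q₁ → ClosedIn {N} X p₂ q₂ →
    Empty (interval {N} X p₁ q₁ ∩ interval {N} X p₂ q₂) ⊎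
    (interval {N} X p₁ q₁ ⊆ interval {N} X p₂ q₂)
proposition2p3 N _ X p₁ q₁ p₂ q₂ _ _ ∣I₁∣≤∣I₂∣ closed₁ closed₂
  with nonempty? (interval {N} X p₁ q₁ ∩ interval {N} X p₂ q₂)
... | no  disjoint = inj₁ disjoint
... | yes (x , x∈I₁∩I₂)
  with ClosedIn-comparable X closed₁ closed₂ (proj₁ x∈both) (proj₂ x∈both)
  where x∈both = x∈p∩q⁻ (interval {N} X p₁ q₁) (interval {N} X p₂ q₂) x∈I₁∩I₂
...   | inj₁ I₁⊆I₂ = inj₂ I₁⊆I₂
...   | inj₂ I₂⊆I₁ = inj₂ (p⊆q⇒∣q∣≤∣p∣⇒q⊆p I₂⊆I₁ ∣I₁∣≤∣I₂∣)
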